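{- Let $\Gamma=(V,E)$ be a finite connected regular graph, $G\le\mathrm{Aut}\,\Gamma$ transitive on $V$, $N\ne1$ a normal subgroup of $G$, and $\Delta$ a single $G$-orbit on the arc set of $\Gamma$, regarded as a digraph on $V$, and assume $\Delta$ is connected. Let $\alpha\in V$ and $\beta\in\Delta(\alpha)$. Then $\pi(N_{\alpha\beta}^{\Delta(\beta)})=\pi(N_{\alpha\beta})$.
   Context: Arcs of $\Gamma$ are ordered pairs $(\alpha,\beta)$ with $\{\alpha,\beta\}\in E$. $\Delta(\alpha)=\{\beta\in V\mid(\alpha,\beta)\in\Delta\}$. $N_{\alpha\beta}$ is the pointwise stabilizer of $\alpha,\beta$ in $N$, and $N_{\alpha\beta}^{\Delta(\beta)}$ is the permutation group it induces on $\Delta(\beta)$. For a finite group $Y$, $\pi(Y)$ is the set of prime divisors of $|Y|$. -}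

module Defs where

open import Data.Nat using (ℕ)
open import Data.Nat.Divisibility using (_∣_)
open import Data.Nat.Primality using (Prime)
open import Data.Bool using (Bool; true; false; T; _∧_; not)
open import Data.Fin using (Fin; _≟_)
open import Data.List using (List; length; filter; deduplicateᵇ)
open import Data.Bool.ListAction using (any; all)
open import Data.List.Relation.Unary.Any using (Any)
open import Data.Fin.Base using ()
open import Data.List using (allFin)
open import Data.Product using (Σ; ∃; _×_; _,_)
open import Relation.Binary.PropositionalEquality using (_≡_; _≢_)
open import Relation.Binary.Construct.Closure.ReflexiveTransitive using (Star)
open import Relation.Nullary.Decidable using (⌊_⌋)
open import Function using (_∘_; _⇔_)

record Perm (n : ℕ) : Set where
  field
    to      : Fin n → Fin n
    from    : Fin n → Fin n
    to-from : ∀ x → to (from x) ≡ x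
    from-to : ∀ x → from (to x) ≡ x
open Perm public

idP : ∀ {n} → Perm n
idP = record { to = λ x → x ; from = λ x → x ; to-from = λ _ → _≡_.refl ; from-to = λ _ → _≡_.refl }

_∘P_ : ∀ {n} → Perm n → Perm n → Perm n
_∘P_ {n} g h = record
  { to = to g ∘ to h ; from = from h ∘ from g
  ; to-from = λ x → tf x ; from-to = λ x → ft x }
  where
  open Relation.Binary.PropositionalEquality
  tf : ∀ x → to g (to h (from h (from g x))) ≡ x
  tf x = trans (cong (to g) (to-from h (from g x))) (to-from g x)
  ft : ∀ x → from h (from g (to g (to h x))) ≡ x
  ft x = trans (cong (from h) (from-to g (to h x))) (from-to h x)

invP : ∀ {n} → Perm n → Perm n
invP g = record { to = from g ; from = to g ; to-from = from-to g ; from-to = to-from g }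

_≈P_ : ∀ {n} → Perm n → Perm n → Set
g ≈P h = ∀ x → to g x ≡ to h x

agreeOnᵇ : ∀ {n} → (Fin n → Bool) → Perm n → Perm n → Bool
agreeOnᵇ {n} P g h = all (λ x → not (P x) Data.Bool.∨ ⌊ to g x ≟ to h x ⌋) (allFin n)

-- Finite permutation groups, represented by a list of their elements
-- (membership up to pointwise equality; duplicates are allowed, the order
-- counts distinct elements).

_∈G_ : ∀ {n} → Perm n → List (Perm n) → Set
g ∈G H = Any (λ h → h ≈P g) H

_⊆G_ : ∀ {n} → List (Perm n) → List (Perm n) → Set
H ⊆G K = ∀ g → g ∈G H → g ∈G K

record IsPermGroup {n : ℕ} (H : List (Perm n)) : Set where
  field
    id-closed  : idP ∈G H
    comp-closed : ∀ g h → g ∈G H → h ∈G H → (g ∘P h) ∈G H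
    inv-closed  : ∀ g → g ∈G H → invP g ∈G H

order : ∀ {n} → List (Perm n) → ℕ
order {n} H = length (deduplicateᵇ (agreeOnᵇ (λ _ → true)) H)

IsNormalSubgroup : ∀ {n} → List (Perm n) → List (Perm n) → Set
IsNormalSubgroup N G =
  IsPermGroup N × N ⊆G G ×
  (∀ g h → g ∈G G → h ∈G N → ((g ∘P h) ∘P invP g) ∈G N)

NonTrivial : ∀ {n} → List (Perm n) → Set
NonTrivial {n} N = Σ (Perm n) λ g → g ∈G N × Σ (Fin n) λ x → to g x ≢ x

IsTransitive : ∀ {n} → List (Perm n) → Set
IsTransitive {n} G = ∀ (x y : Fin n) → Σ (Perm n) λ g → g ∈G G × to g x ≡ y

record SimpleGraph (n : ℕ) : Set where
  field
    Adj   : Fin n → Fin n → Bool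
    sym   : ∀ x y → Adj x y ≡ Adj y x
    irrefl : ∀ x → Adj x x ≡ false
open SimpleGraph public

degree : ∀ {n} → SimpleGraph n → Fin n → ℕ
degree {n} Γ v = length (filter (λ w → T? (Adj Γ v w)) (allFin n))
  where open import Relation.Nullary.Decidable using (T?)

IsRegular : ∀ {n} → SimpleGraph n → Set
IsRegular Γ = Σ ℕ λ k → ∀ v → degree Γ v ≡ k

SymClosure : ∀ {n} → (Fin n → Fin n → Bool) → Fin n → Fin n → Set
SymClosure R x y = T (R x y) Data.Sum.⊎ T (R y x)
  where import Data.Sum

IsConnectedRel : ∀ {n} → (Fin n → Fin n → Bool) → Set
IsConnectedRel {n} R = ∀ (x y : Fin n) → Star (SymClosure R) x y

IsConnected : ∀ {n} → SimpleGraph n → Set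
IsConnected Γ = IsConnectedRel (Adj Γ)

IsAutGroup : ∀ {n} → SimpleGraph n → List (Perm n) → Set
IsAutGroup Γ G = IsPermGroup G × (∀ g → g ∈G G → ∀ x y → Adj Γ (to g x) (to g y) ≡ Adj Γ x y)

-- The G-orbit on arcs containing the arc (a , b), as a digraph on Fin n:
-- (x , y) ∈ Δ iff (x , y) = (a^g , b^g) for some g ∈ G.

arcOrbit : ∀ {n} → List (Perm n) → Fin n → Fin n → (Fin n → Fin n → Bool)
arcOrbit G a b x y = any (λ g → ⌊ to g a ≟ x ⌋ ∧ ⌊ to g b ≟ y ⌋) G

stab2 : ∀ {n} → List (Perm n) → Fin n → Fin n → List (Perm n)
stab2 N α β = filter (λ g → T? (⌊ to g α ≟ α ⌋ ∧ ⌊ to g β ≟ β ⌋)) N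
  where open import Relation.Nullary.Decidable using (T?)

-- order of the permutation group induced by the list H on the subset
-- {x | P x}: the number of distinct restrictions to that subset.
inducedOrder : ∀ {n} → (Fin n → Bool) → List (Perm n) → ℕ
inducedOrder P H = length (deduplicateᵇ (agreeOnᵇ P) H)

SamePrimeDivisors : ℕ → ℕ → Set
SamePrimeDivisors a b = ∀ (p : ℕ) → Prime p → (p ∣ a ⇔ p ∣ b)

-- Let q = |N_αβ^Δ(β)|.  Restriction to Δ(β) maps N_αβ onto N_αβ^Δ(β),
-- so q divides |N_αβ|.  Conversely, let S ∋ α, β be a vertex set and u → w an
-- arc inside S.  Then |N_(S)| = |N_(S)^Δ(w)| · |N_(S ∪ Δ(w))|, and N_(S)^Δ(w) is
-- a subgroup of N_uw^Δ(w), which is conjugate to N_αβ^Δ(β) because G is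
-- transitive on the arcs of Δ and normalises N; so the first factor divides q.
-- Enlarging S in this way until no arc inside S leads out of S makes S = V,
-- since Δ is strongly connected (a connected digraph invariant under a
-- vertex-transitive group), and N_(V) = 1.  So every prime divisor of |N_αβ|
-- divides q.

module Submission where

open import Defs hiding (sym; irrefl)

open import Level using (0ℓ)
open import Function using (_⇔_; mk⇔; Equivalence; case_of_)
open import Data.Empty using (⊥-elim)
open import Data.Unit using (tt)
open import Data.Product using (∃; _×_; _,_; proj₁; proj₂)
open import Data.Sum using (inj₁; inj₂)
open import Data.Bool using (Bool; true; false; T; not; _∨_; _∧_)
open import Data.Bool.Properties using (T-∨; T-∧)
open import Data.Bool.ListAction using (any)
open import Data.Nat using (ℕ; zero; suc; _+_; _*_; _≤_; _<_; z≤n; s≤s)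
open import Data.Nat.Properties
  using (≤-antisym; <-≤-trans; ≤-refl; ≤-pred; n≮0; m≤n⇒m≤1+n; n<1+n; +-suc; m≤n⇒∃[o]m+o≡n)
open import Data.Nat.GeneralisedArithmetic using (fold; fold-+)
open import Data.Nat.Divisibility using (_∣_; divides; ∣-trans; ∣1⇒≡1; m∣m*n)
open import Data.Nat.Primality using (Prime; euclidsLemma; ¬prime[1])
open import Data.Fin using (Fin; _≟_; toℕ)
import Data.Fin.Properties as Fin
open import Data.List
  using (List; []; _∷_; _++_; length; filter; map; deduplicate; cartesianProductWith; allFin)
open import Data.List.Properties using (filter-notAll; length-map; length-++)
open import Data.List.Relation.Unary.Any as Any using (Any; here; there)
open import Data.List.Relation.Unary.Any.Properties using (any⁺; any⁻)
open import Data.List.Relation.Unary.All as All using (All)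
open import Data.List.Relation.Unary.All.Properties using (all⁺; all⁻)
open import Data.List.Relation.Unary.AllPairs as AllPairs using ([]; _∷_)
open import Data.List.Membership.Propositional using (_∈_; find; lose)
open import Data.List.Membership.Propositional.Properties
  using (∈-allFin; ∈-filter⁺; ∈-filter⁻; ∈-deduplicate⁻; ∈-map⁺; ∈-map⁻;
         ∈-cartesianProductWith⁺; ∈-cartesianProductWith⁻)
import Data.List.Membership.Setoid as SetoidMembership
import Data.List.Membership.Setoid.Properties as SetoidMembershipₚ
import Data.List.Relation.Binary.Subset.Setoid as SetoidSubset
import Data.List.Relation.Binary.Subset.Setoid.Properties as SetoidSubsetₚ
import Data.List.Relation.Unary.Unique.Setoid as SetoidUnique
import Data.List.Relation.Unary.Unique.Setoid.Properties as SetoidUniqueₚ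
import Data.List.Relation.Unary.Unique.DecSetoid.Properties as DecSetoidUniqueₚ
open import Data.List.Relation.Binary.Disjoint.Setoid using (Disjoint)
open import Relation.Binary.Bundles using (DecSetoid)
open import Relation.Binary.PropositionalEquality as ≡ using (_≡_)
open import Relation.Binary.Construct.Closure.ReflexiveTransitive using (Star; ε; _◅_; _◅◅_)
open import Relation.Nullary using (¬_; Dec; yes; no)
open import Relation.Nullary.Negation using (contraposition)
open import Relation.Nullary.Decidable using (T?; ¬?; ⌊_⌋; toWitness; fromWitness; _×-dec_)

module Classes {c ℓ} (S : DecSetoid c ℓ) where

  open DecSetoid S using (Carrier; _≈_; setoid; refl; sym; trans) renaming (_≟_ to _≈?_)
  open SetoidMembership setoid using () renaming (_∈_ to _∈≈_)
  open SetoidSubset setoid using (_⊆_)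
  open SetoidUnique setoid using (Unique)

  representatives : List Carrier → List Carrier
  representatives = deduplicate _≈?_

  #classes : List Carrier → ℕ
  #classes xs = length (representatives xs)

  representatives-unique : ∀ xs → Unique (representatives xs)
  representatives-unique = DecSetoidUniqueₚ.deduplicate-! S

  representative-∈ : ∀ {xs x} → x ∈ representatives xs → x ∈ xs
  representative-∈ {xs} = ∈-deduplicate⁻ _≈?_ xs

  ⊆-from-∈ : ∀ {xs ys} → (∀ {x} → x ∈ xs → x ∈ ys) → xs ⊆ ys
  ⊆-from-∈ sub x∈xs = let y , y∈xs , x≈y = find x∈xs in lose (sub y∈xs) x≈y

  ∈⇒∈≈ : ∀ {x xs} → x ∈ xs → x ∈≈ xs
  ∈⇒∈≈ x∈xs = lose x∈xs refl

  representatives-⊆ : ∀ {xs} → representatives xs ⊆ xs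
  representatives-⊆ = ⊆-from-∈ representative-∈

  ⊆-representatives : ∀ {xs} → xs ⊆ representatives xs
  ⊆-representatives = SetoidMembershipₚ.∈-deduplicate⁺ setoid _≈?_ (λ z≈y x≈y → trans x≈y (sym z≈y))

  unique-length-≤ : ∀ {xs ys} → Unique xs → xs ⊆ ys → length xs ≤ length ys
  unique-length-≤ {[]} _ _ = z≤n
  unique-length-≤ {x ∷ xs} {ys} (x≉xs ∷ xs!) x∷xs⊆ys =
    <-≤-trans (s≤s (unique-length-≤ xs! xs⊆others)) (filter-notAll x≉? ys x∈ys)
    where
    x≉? : (y : Carrier) → Dec (¬ x ≈ y)
    x≉? y = ¬? (x ≈? y)
    x∈ys : Any (λ y → ¬ ¬ (x ≈ y)) ys
    x∈ys = Any.map (λ x≈y x≉y → x≉y x≈y) (x∷xs⊆ys (here refl))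
    xs⊆others : xs ⊆ filter x≉? ys
    xs⊆others z∈xs =
      SetoidMembershipₚ.∈-filter⁺ setoid x≉? (λ y≈z x≉y x≈z → x≉y (trans x≈z (sym y≈z)))
        (x∷xs⊆ys (there z∈xs))
        (λ x≈z → let x≉y , z≈y = All.lookupAny x≉xs z∈xs in x≉y (trans x≈z z≈y))

  #classes-unique : ∀ {xs ys} → Unique ys → ys ⊆ xs → xs ⊆ ys → #classes xs ≡ length ys
  #classes-unique {xs} {ys} ys! ys⊆xs xs⊆ys = ≤-antisym
    (unique-length-≤ (representatives-unique xs) (λ z∈ → xs⊆ys (representatives-⊆ z∈)))
    (unique-length-≤ ys! (λ z∈ → ⊆-representatives (ys⊆xs z∈)))

  #classes-cong : ∀ {xs ys} → xs ⊆ ys → ys ⊆ xs → #classes xs ≡ #classes ys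
  #classes-cong {ys = ys} xs⊆ys ys⊆xs = #classes-unique (representatives-unique ys)
    (λ z∈ → ys⊆xs (representatives-⊆ z∈)) (λ z∈ → ⊆-representatives (xs⊆ys z∈))

module _ {c₁ ℓ₁ c₂ ℓ₂} (S : DecSetoid c₁ ℓ₁) (S' : DecSetoid c₂ ℓ₂) where

  private
    module S = DecSetoid S
    module S' = DecSetoid S'
  open SetoidSubset S'.setoid using (_⊆_)
  open Classes

  #classes-map : ∀ (f : S.Carrier → S'.Carrier) {xs ys} →
    (∀ {x y} → x S.≈ y → f x S'.≈ f y) → (∀ {x y} → f x S'.≈ f y → x S.≈ y) →
    map f xs ⊆ ys → ys ⊆ map f xs → #classes S xs ≡ #classes S' ys
  #classes-map f {xs} {ys} f-cong f-inj fxs⊆ys ys⊆fxs = ≡.sym (≡.trans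
    (#classes-unique S' (SetoidUniqueₚ.map⁺ S.setoid S'.setoid f-inj (representatives-unique S xs))
      (λ z∈ → fxs⊆ys (SetoidSubsetₚ.map⁺ S.setoid S'.setoid f-cong (representatives-⊆ S) z∈))
      (λ z∈ → SetoidSubsetₚ.map⁺ S.setoid S'.setoid f-cong (⊆-representatives S) (ys⊆fxs z∈)))
    (length-map f (representatives S xs)))

T-implies : ∀ {b c} → T (not b ∨ c) ⇔ (T b → T c)
T-implies {true} = mk⇔ (λ c _ → c) (λ b⇒c → b⇒c tt)
T-implies {false} = mk⇔ (λ _ ()) (λ _ → tt)

record Agree {n} (P : Fin n → Bool) (g h : Perm n) : Set where
  constructor agreeing
  field agree-at : ∀ x → T (P x) → to g x ≡ to h x
open Agree public

Fixes : ∀ {n} → (Fin n → Bool) → Perm n → Set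
Fixes P g = Agree P g idP

Preserves : ∀ {n} → (Fin n → Bool) → Perm n → Set
Preserves P g = ∀ x → T (P x) → T (P (to g x))

agree⁻ : ∀ {n} (P : Fin n → Bool) {g h} → T (agreeOnᵇ P g h) → Agree P g h
agree⁻ {n} P {g} {h} t = agreeing λ x Px →
  toWitness (Equivalence.to T-implies (All.lookup (all⁺ _ (allFin n) t) (∈-allFin x)) Px)

agree⁺ : ∀ {n} (P : Fin n → Bool) {g h} → Agree P g h → T (agreeOnᵇ P g h)
agree⁺ {n} P g≈h = all⁻ _ {xs = allFin n}
  (All.tabulate (λ {x} _ → Equivalence.from T-implies (λ Px → fromWitness (agree-at g≈h x Px))))

agree-refl : ∀ {n} {P : Fin n → Bool} {g} → Agree P g g
agree-refl = agreeing λ _ _ → ≡.refl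

agree-sym : ∀ {n} {P : Fin n → Bool} {g h} → Agree P g h → Agree P h g
agree-sym g≈h = agreeing λ x Px → ≡.sym (agree-at g≈h x Px)

agree-trans : ∀ {n} {P : Fin n → Bool} {g h k} → Agree P g h → Agree P h k → Agree P g k
agree-trans g≈h h≈k = agreeing λ x Px → ≡.trans (agree-at g≈h x Px) (agree-at h≈k x Px)

-- Permutations up to agreement on P.  Its classes are the restrictions to P,
-- and Classes.#classes (agreement P) H is by definition inducedOrder P H.
agreement : ∀ {n} → (Fin n → Bool) → DecSetoid 0ℓ 0ℓ
agreement {n} P = record
  { Carrier = Perm n
  ; _≈_ = λ g h → T (agreeOnᵇ P g h)
  ; isDecEquivalence = record
    { isEquivalence = record
      { refl = λ {g} → agree⁺ P {g} {g} agree-refl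
      ; sym = λ {g} {h} g≈h → agree⁺ P {h} {g} (agree-sym (agree⁻ P {g} {h} g≈h))
      ; trans = λ {g} {h} {k} g≈h h≈k →
          agree⁺ P {g} {k} (agree-trans (agree⁻ P {g} {h} g≈h) (agree⁻ P {h} {k} h≈k)) }
    ; _≟_ = λ g h → T? (agreeOnᵇ P g h) } }

module _ {n : ℕ} {P : Fin n → Bool} where

  agree-≈P : ∀ {g h} → g ≈P h → Agree P g h
  agree-≈P g≈h = agreeing λ x _ → g≈h x

  agree-∘ˡ : ∀ f {g h} → Agree P g h → Agree P (f ∘P g) (f ∘P h)
  agree-∘ˡ f g≈h = agreeing λ x Px → ≡.cong (to f) (agree-at g≈h x Px)

  agree-cancelˡ : ∀ f {g h} → Agree P (f ∘P g) (f ∘P h) → Agree P g h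
  agree-cancelˡ f {g} {h} fg≈fh = agreeing λ x Px → begin
    to g x                   ≡⟨ ≡.sym (from-to f (to g x)) ⟩
    from f (to f (to g x))   ≡⟨ ≡.cong (from f) (agree-at fg≈fh x Px) ⟩
    from f (to f (to h x))   ≡⟨ from-to f (to h x) ⟩
    to h x                   ∎
    where open ≡.≡-Reasoning

  agree-∘ʳ : ∀ {g h} k → Preserves P k → Agree P g h → Agree P (g ∘P k) (h ∘P k)
  agree-∘ʳ k k-pres g≈h = agreeing λ x Px → agree-at g≈h _ (k-pres x Px)

  fixes-id : Fixes P idP
  fixes-id = agree-refl

  fixes-∘ : ∀ {g h} → Fixes P g → Fixes P h → Fixes P (g ∘P h)
  fixes-∘ {g} g-fix h-fix = agreeing λ x Px →
    ≡.trans (≡.cong (to g) (agree-at h-fix x Px)) (agree-at g-fix x Px)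

  fixes-inv : ∀ {g} → Fixes P g → Fixes P (invP g)
  fixes-inv {g} g-fix = agreeing λ x Px →
    ≡.trans (≡.cong (from g) (≡.sym (agree-at g-fix x Px))) (from-to g x)

  fixes-≈P : ∀ {g h} → g ≈P h → Fixes P g → Fixes P h
  fixes-≈P g≈h g-fix = agree-trans (agree-sym (agree-≈P g≈h)) g-fix

opaque
  Fixer : ∀ {n} → (Fin n → Bool) → List (Perm n) → List (Perm n)
  Fixer P H = filter (λ g → T? (agreeOnᵇ P g idP)) H

∈⇒∈G : ∀ {n} {g : Perm n} {H} → g ∈ H → g ∈G H
∈⇒∈G g∈H = lose g∈H (λ _ → ≡.refl)

module _ {n : ℕ} {P : Fin n → Bool} {H : List (Perm n)} where

  opaque
    unfolding Fixer

    ∈-Fixer⁻ : ∀ {g} → g ∈ Fixer P H → g ∈ H × Fixes P g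
    ∈-Fixer⁻ {g} g∈ =
      let g∈H , fixed = ∈-filter⁻ (λ g → T? (agreeOnᵇ P g idP)) {xs = H} g∈
      in g∈H , agree⁻ P fixed

    ∈-Fixer⁺ : ∀ {g} → g ∈ H → Fixes P g → g ∈ Fixer P H
    ∈-Fixer⁺ {g} g∈H g-fix = ∈-filter⁺ (λ g → T? (agreeOnᵇ P g idP)) g∈H (agree⁺ P g-fix)

  ∈G-Fixer⁻ : ∀ {g} → g ∈G Fixer P H → g ∈G H × Fixes P g
  ∈G-Fixer⁻ g∈ =
    let h , h∈ , h≈g = find g∈
        h∈H , h-fix = ∈-Fixer⁻ h∈
    in lose h∈H h≈g , fixes-≈P h≈g h-fix

  ∈G-Fixer⁺ : ∀ {g} → g ∈G H → Fixes P g → g ∈G Fixer P H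
  ∈G-Fixer⁺ g∈ g-fix =
    let h , h∈H , h≈g = find g∈
    in lose (∈-Fixer⁺ h∈H (fixes-≈P (λ x → ≡.sym (h≈g x)) g-fix)) h≈g

  fixer-group : IsPermGroup H → IsPermGroup (Fixer P H)
  fixer-group H-group = record
    { id-closed = ∈G-Fixer⁺ id-closed fixes-id
    ; comp-closed = λ g h g∈ h∈ →
        let g∈H , g-fix = ∈G-Fixer⁻ {g} g∈ ; h∈H , h-fix = ∈G-Fixer⁻ {h} h∈
        in ∈G-Fixer⁺ (comp-closed g h g∈H h∈H) (fixes-∘ g-fix h-fix)
    ; inv-closed = λ g g∈ →
        let g∈H , g-fix = ∈G-Fixer⁻ {g} g∈ in ∈G-Fixer⁺ (inv-closed g g∈H) (fixes-inv g-fix) }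
    where open IsPermGroup H-group

length-cartesianProductWith : ∀ {A B C : Set} (f : A → B → C) xs ys →
  length (cartesianProductWith f xs ys) ≡ length xs * length ys
length-cartesianProductWith f [] ys = ≡.refl
length-cartesianProductWith f (x ∷ xs) ys = begin
  length (map (f x) ys ++ cartesianProductWith f xs ys)             ≡⟨ length-++ (map (f x) ys) ⟩
  length (map (f x) ys) + length (cartesianProductWith f xs ys)     ≡⟨ ≡.cong₂ _+_ (length-map (f x) ys) (length-cartesianProductWith f xs ys) ⟩
  length ys + length xs * length ys                                 ∎
  where open ≡.≡-Reasoning

-- Call h, h' equivalent when h' agrees
-- on Q with some hk, k ∈ K.  Products of a representative of each such class
-- with a representative of each restriction k|Q are pairwise distinct on Q and
-- exhaust H|Q; hence |H|Q| = (number of classes) · |K|Q|.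
module Cosets {n : ℕ} (Q : Fin n → Bool) {H K : List (Perm n)}
    (H-group : IsPermGroup H) (K-group : IsPermGroup K) (K⊆H : K ⊆G H)
    (K-preserves : ∀ {k} → k ∈ K → Preserves Q k) where

  private
    module H = IsPermGroup H-group
    module K = IsPermGroup K-group
    module Q = DecSetoid (agreement Q)
    open SetoidSubset Q.setoid using () renaming (_⊆_ to _⊆Q_)
    open SetoidUnique Q.setoid using () renaming (Unique to UniqueQ)

  SameCoset : Perm n → Perm n → Set
  SameCoset h h' = ∃ λ k → k ∈ K × Agree Q (h ∘P k) h'

  sameCosetᵇ : Perm n → Perm n → Bool
  sameCosetᵇ h h' = any (λ k → agreeOnᵇ Q (h ∘P k) h') K

  sameCoset⁻ : ∀ {h h'} → T (sameCosetᵇ h h') → SameCoset h h'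
  sameCoset⁻ {h} {h'} t =
    let k , k∈K , hk≈h' = find (any⁻ (λ k → agreeOnᵇ Q (h ∘P k) h') K t)
    in k , k∈K , agree⁻ Q hk≈h'

  sameCoset⁺ : ∀ {h h'} → SameCoset h h' → T (sameCosetᵇ h h')
  sameCoset⁺ {h} {h'} (k , k∈K , hk≈h') =
    any⁺ (λ k → agreeOnᵇ Q (h ∘P k) h') (lose k∈K (agree⁺ Q {h ∘P k} {h'} hk≈h'))

  sameCoset-refl : ∀ {h} → SameCoset h h
  sameCoset-refl {h} with find K.id-closed
  ... | k , k∈K , k≈id = k , k∈K , agree-≈P {g = h ∘P k} {h} (λ x → ≡.cong (to h) (k≈id x))

  sameCoset-sym : ∀ {h h'} → SameCoset h h' → SameCoset h' h
  sameCoset-sym {h} {h'} (k , k∈K , hk≈h') with find (K.inv-closed k (∈⇒∈G k∈K))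
  ... | k' , k'∈K , k'≈k⁻¹ = k' , k'∈K , agree-trans {g = h' ∘P k'} h'k'≈hkk' hkk'≈h
    where
    h'k'≈hkk' : Agree Q (h' ∘P k') ((h ∘P k) ∘P k')
    h'k'≈hkk' = agree-sym (agree-∘ʳ k' (K-preserves k'∈K) hk≈h')
    hkk'≈h : Agree Q ((h ∘P k) ∘P k') h
    hkk'≈h = agree-≈P λ x →
      ≡.trans (≡.cong (λ y → to h (to k y)) (k'≈k⁻¹ x)) (≡.cong (to h) (to-from k x))

  sameCoset-trans : ∀ {h h' h''} → SameCoset h h' → SameCoset h' h'' → SameCoset h h''
  sameCoset-trans {h} {h'} {h''} (k , k∈K , hk≈h') (k' , k'∈K , h'k'≈h'')
    with find (K.comp-closed k k' (∈⇒∈G k∈K) (∈⇒∈G k'∈K))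
  ... | k'' , k''∈K , k''≈kk' = k'' , k''∈K , agree-trans hk''≈hkk' (agree-trans hkk'≈h'k' h'k'≈h'')
    where
    hk''≈hkk' : Agree Q (h ∘P k'') ((h ∘P k) ∘P k')
    hk''≈hkk' = agree-≈P λ x → ≡.cong (to h) (k''≈kk' x)
    hkk'≈h'k' : Agree Q ((h ∘P k) ∘P k') (h' ∘P k')
    hkk'≈h'k' = agree-∘ʳ k' (K-preserves k'∈K) hk≈h'

  cosets : DecSetoid 0ℓ 0ℓ
  cosets = record
    { Carrier = Perm n
    ; _≈_ = λ h h' → T (sameCosetᵇ h h')
    ; isDecEquivalence = record
      { isEquivalence = record
        { refl = λ {h} → sameCoset⁺ {h} {h} sameCoset-refl
        ; sym = λ {h} {h'} e → sameCoset⁺ {h'} {h} (sameCoset-sym (sameCoset⁻ {h} {h'} e))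
        ; trans = λ {h} {h'} {h''} e e' →
            sameCoset⁺ {h} {h''}
              (sameCoset-trans {h} {h'} {h''} (sameCoset⁻ {h} {h'} e) (sameCoset⁻ {h'} {h''} e')) }
      ; _≟_ = λ h h' → T? (sameCosetᵇ h h') } }

  private
    module CosetSetoid = DecSetoid cosets
    module ByCoset = Classes cosets
    module ByRestriction = Classes (agreement Q)
    open SetoidUnique CosetSetoid.setoid using () renaming (Unique to UniqueC)

    R DK : List (Perm n)
    R = ByCoset.representatives H
    DK = ByRestriction.representatives K

  sameCoset-products : ∀ {r r' k k'} → k ∈ K → k' ∈ K → Agree Q (r ∘P k) (r' ∘P k') → SameCoset r r'
  sameCoset-products {r} {r'} {k} {k'} k∈K k'∈K rk≈r'k' with find (K.inv-closed k' (∈⇒∈G k'∈K))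
  ... | k₁ , k₁∈K , k₁≈k'⁻¹ with find (K.comp-closed k k₁ (∈⇒∈G k∈K) (∈⇒∈G k₁∈K))
  ... | k₂ , k₂∈K , k₂≈kk₁ = k₂ , k₂∈K , agree-trans rk₂≈rkk₁ (agree-trans rkk₁≈r'k'k₁ r'k'k₁≈r')
    where
    rk₂≈rkk₁ : Agree Q (r ∘P k₂) ((r ∘P k) ∘P k₁)
    rk₂≈rkk₁ = agree-≈P λ x → ≡.cong (to r) (k₂≈kk₁ x)
    rkk₁≈r'k'k₁ : Agree Q ((r ∘P k) ∘P k₁) ((r' ∘P k') ∘P k₁)
    rkk₁≈r'k'k₁ = agree-∘ʳ k₁ (K-preserves k₁∈K) rk≈r'k'
    r'k'k₁≈r' : Agree Q ((r' ∘P k') ∘P k₁) r'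
    r'k'k₁≈r' = agree-≈P λ x →
      ≡.trans (≡.cong (λ y → to r' (to k' y)) (k₁≈k'⁻¹ x)) (≡.cong (to r') (to-from k' x))

  products-unique : ∀ {rs} → UniqueC rs → UniqueQ (cartesianProductWith _∘P_ rs DK)
  products-unique {[]} [] = []
  products-unique {r ∷ rs} (r≁rs ∷ rs!) = SetoidUniqueₚ.++⁺ Q.setoid
    (SetoidUniqueₚ.map⁺ Q.setoid Q.setoid {f = r ∘P_} (λ {g} {h} → cancel {g} {h})
      (ByRestriction.representatives-unique K))
    (products-unique {rs} rs!) (λ {v} → disjoint {v})
    where
    cancel : ∀ {g h} → T (agreeOnᵇ Q (r ∘P g) (r ∘P h)) → T (agreeOnᵇ Q g h)
    cancel {g} {h} e = agree⁺ Q {g} {h} (agree-cancelˡ r (agree⁻ Q {r ∘P g} {r ∘P h} e))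
    disjoint : Disjoint Q.setoid (map (r ∘P_) DK) (cartesianProductWith _∘P_ rs DK)
    disjoint {v} (v∈rDK , v∈rsDK) with find v∈rDK | find v∈rsDK
    ... | x , x∈ , v≈x | y , y∈ , v≈y with ∈-map⁻ (r ∘P_) x∈ | ∈-cartesianProductWith⁻ _∘P_ rs DK y∈
    ... | k , k∈DK , ≡.refl | r' , k' , r'∈rs , k'∈DK , ≡.refl =
      All.lookup r≁rs r'∈rs (sameCoset⁺ {r} {r'}
        (sameCoset-products {r} {r'} {k} {k'}
          (ByRestriction.representative-∈ k∈DK) (ByRestriction.representative-∈ k'∈DK)
          (agree⁻ Q {r ∘P k} {r' ∘P k'} (Q.trans {r ∘P k} {v} {r' ∘P k'} (Q.sym {v} {r ∘P k} v≈x) v≈y))))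

  products⊆H : cartesianProductWith _∘P_ R DK ⊆Q H
  products⊆H {v} v∈ with find v∈
  ... | y , y∈ , v≈y with ∈-cartesianProductWith⁻ _∘P_ R DK y∈
  ... | r , k , r∈R , k∈DK , ≡.refl
    with find (H.comp-closed r k (∈⇒∈G (ByCoset.representative-∈ r∈R))
                                 (K⊆H k (∈⇒∈G (ByRestriction.representative-∈ k∈DK))))
  ... | h , h∈H , h≈rk =
    lose h∈H (Q.trans {v} {r ∘P k} {h} v≈y (agree⁺ Q {r ∘P k} {h} (agree-≈P λ x → ≡.sym (h≈rk x))))

  -- Every h ∈ H agrees on Q with a product r k: take r representing the coset
  -- of h, so that h ≈ r k for some k ∈ K, and replace k by its representative.
  H⊆products : H ⊆Q cartesianProductWith _∘P_ R DK
  H⊆products {v} v∈ with find v∈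
  ... | h , h∈H , v≈h with find (ByCoset.⊆-representatives {H} {h} (ByCoset.∈⇒∈≈ {h} {H} h∈H))
  ... | r , r∈R , h~r with sameCoset⁻ {r} {h} (CosetSetoid.sym {h} {r} h~r)
  ... | k , k∈K , rk≈h with find (ByRestriction.⊆-representatives {K} {k} (ByRestriction.∈⇒∈≈ {k} {K} k∈K))
  ... | k' , k'∈DK , k≈k' = lose (∈-cartesianProductWith⁺ _∘P_ r∈R k'∈DK) (agree⁺ Q {v} {r ∘P k'} v≈rk')
    where
    v≈rk' : Agree Q v (r ∘P k')
    v≈rk' = agree-trans (agree⁻ Q {v} {h} v≈h)
              (agree-trans (agree-sym rk≈h) (agree-∘ˡ r (agree⁻ Q {k} {k'} k≈k')))

  lagrange : inducedOrder Q H ≡ ByCoset.#classes H * inducedOrder Q K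
  lagrange = ≡.trans
    (ByRestriction.#classes-unique (products-unique {R} (ByCoset.representatives-unique H))
       (λ {v} → products⊆H {v}) (λ {v} → H⊆products {v}))
    (length-cartesianProductWith _∘P_ R DK)

inducedOrder-∣ : ∀ {n} (Q : Fin n → Bool) {H K : List (Perm n)} →
  IsPermGroup H → IsPermGroup K → K ⊆G H → (∀ {k} → k ∈ K → Preserves Q k) →
  inducedOrder Q K ∣ inducedOrder Q H
inducedOrder-∣ Q {H} H-group K-group K⊆H K-preserves = divides (Classes.#classes cosets H) lagrange
  where open Cosets Q H-group K-group K⊆H K-preserves

-- Restricting to P is a homomorphism with kernel the pointwise stabiliser:
-- |H| = |H|P| · |H_(P)|.
order-restriction : ∀ {n} (P : Fin n → Bool) {H : List (Perm n)} →
  IsPermGroup H → order H ≡ inducedOrder P H * order (Fixer P H)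
order-restriction {n} P {H} H-group =
  ≡.trans lagrange (≡.cong (_* order (Fixer P H)) cosets≡restrictions)
  where
  open Cosets (λ _ → true) H-group (fixer-group {P = P} H-group)
    (λ g g∈ → proj₁ (∈G-Fixer⁻ {P = P} {g = g} g∈)) (λ _ _ _ → tt)
  module H = IsPermGroup H-group
  module ByCoset = Classes cosets
  module ByRestriction = Classes (agreement P)
  open SetoidMembership (DecSetoid.setoid cosets) using () renaming (_∈_ to _∈C_)
  D : List (Perm n)
  D = ByRestriction.representatives H

  sameCoset⇒agree : ∀ {h h'} → T (sameCosetᵇ h h') → T (agreeOnᵇ P h h')
  sameCoset⇒agree {h} {h'} t with sameCoset⁻ {h} {h'} t
  ... | k , k∈ , hk≈h' = agree⁺ P {h} {h'} (agreeing λ x Px →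
    ≡.trans (≡.cong (to h) (≡.sym (agree-at (proj₂ (∈-Fixer⁻ {P = P} {H = H} k∈)) x Px)))
            (agree-at hk≈h' x tt))

  agree⇒sameCoset : ∀ {h h'} → h ∈ H → h' ∈ H → Agree P h h' → SameCoset h h'
  agree⇒sameCoset {h} {h'} h∈H h'∈H h≈h'
    with find (H.comp-closed (invP h) h' (H.inv-closed h (∈⇒∈G h∈H)) (∈⇒∈G h'∈H))
  ... | k , k∈H , k≈h⁻¹h' = k , ∈-Fixer⁺ k∈H k-fixes , agree-≈P hk≈h'
    where
    hk≈h' : (h ∘P k) ≈P h'
    hk≈h' x = ≡.trans (≡.cong (to h) (k≈h⁻¹h' x)) (to-from h (to h' x))
    k-fixes : Fixes P k
    k-fixes = agreeing λ x Px → begin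
      to k x                 ≡⟨ k≈h⁻¹h' x ⟩
      from h (to h' x)       ≡⟨ ≡.cong (from h) (≡.sym (agree-at h≈h' x Px)) ⟩
      from h (to h x)        ≡⟨ from-to h x ⟩
      x                      ∎
      where open ≡.≡-Reasoning

  H⊆D : ∀ {v} → v ∈C H → v ∈C D
  H⊆D {v} v∈ with find v∈
  ... | h , h∈H , v~h with find (ByRestriction.⊆-representatives {H} {h} (ByRestriction.∈⇒∈≈ {h} {H} h∈H))
  ... | d , d∈D , h≈d = lose d∈D (DecSetoid.trans cosets {v} {h} {d} v~h (sameCoset⁺ {h} {d}
          (agree⇒sameCoset h∈H (ByRestriction.representative-∈ d∈D) (agree⁻ P {h} {d} h≈d))))

  cosets≡restrictions : ByCoset.#classes H ≡ inducedOrder P H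
  cosets≡restrictions = ByCoset.#classes-unique
    (AllPairs.map (λ {h} {h'} → contraposition (sameCoset⇒agree {h} {h'}))
      (ByRestriction.representatives-unique H))
    (λ {v} → ByCoset.⊆-from-∈ {D} {H} (λ {x} → ByRestriction.representative-∈ {H} {x}) {v})
    (λ {v} → H⊆D {v})

_∪_ : ∀ {n} → (Fin n → Bool) → (Fin n → Bool) → Fin n → Bool
(S ∪ P) v = S v ∨ P v

module _ {n : ℕ} {S P : Fin n → Bool} where

  fixes-∪⁺ : ∀ {g} → Fixes S g → Fixes P g → Fixes (S ∪ P) g
  fixes-∪⁺ g-fixes-S g-fixes-P = agreeing λ x x∈S∪P →
    case Equivalence.to (T-∨ {S x}) x∈S∪P of λ where
      (inj₁ x∈S) → agree-at g-fixes-S x x∈S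
      (inj₂ x∈P) → agree-at g-fixes-P x x∈P

  fixes-∪⁻ : ∀ {g} → Fixes (S ∪ P) g → Fixes S g × Fixes P g
  fixes-∪⁻ g-fixes =
      agreeing (λ x x∈S → agree-at g-fixes x (Equivalence.from (T-∨ {S x}) (inj₁ x∈S)))
    , agreeing (λ x x∈P → agree-at g-fixes x (Equivalence.from (T-∨ {S x}) (inj₂ x∈P)))

  order-Fixer-Fixer : ∀ H → order (Fixer P (Fixer S H)) ≡ order (Fixer (S ∪ P) H)
  order-Fixer-Fixer H = #classes-cong {Fixer P (Fixer S H)} {Fixer (S ∪ P) H}
    (λ {g} → ⊆-from-∈ (λ {x} → into {x}) {g}) (λ {g} → ⊆-from-∈ (λ {x} → back {x}) {g})
    where
    open Classes (agreement (λ _ → true))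
    into : ∀ {g} → g ∈ Fixer P (Fixer S H) → g ∈ Fixer (S ∪ P) H
    into g∈ with ∈-Fixer⁻ g∈
    ... | g∈FS , g-fixes-P with ∈-Fixer⁻ g∈FS
    ... | g∈H , g-fixes-S = ∈-Fixer⁺ g∈H (fixes-∪⁺ g-fixes-S g-fixes-P)
    back : ∀ {g} → g ∈ Fixer (S ∪ P) H → g ∈ Fixer P (Fixer S H)
    back g∈ with ∈-Fixer⁻ g∈
    ... | g∈H , g-fixes with fixes-∪⁻ g-fixes
    ... | g-fixes-S , g-fixes-P = ∈-Fixer⁺ (∈-Fixer⁺ g∈H g-fixes-S) g-fixes-P

  order-Fixer-split : ∀ {H} → IsPermGroup H →
    order (Fixer S H) ≡ inducedOrder P (Fixer S H) * order (Fixer (S ∪ P) H)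
  order-Fixer-split {H} H-group = ≡.trans (order-restriction P (fixer-group H-group))
    (≡.cong (inducedOrder P (Fixer S H) *_) (order-Fixer-Fixer H))

order-Fixer-all : ∀ {n} {S : Fin n → Bool} {H} → IsPermGroup H → (∀ v → T (S v)) → order (Fixer S H) ≡ 1
order-Fixer-all {S = S} {H} H-group everything = #classes-unique {Fixer S H} {idP ∷ []} (All.[] ∷ [])
  (λ {v} → id∈Fixer {v}) (λ {v} → Fixer⊆id {v})
  where
  open Classes (agreement (λ _ → true))
  open SetoidMembership (DecSetoid.setoid (agreement (λ _ → true))) using () renaming (_∈_ to _∈≈_)
  id∈Fixer : ∀ {v} → v ∈≈ (idP ∷ []) → v ∈≈ Fixer S H
  id∈Fixer {v} (here v≈id) with find (∈G-Fixer⁺ {P = S} (IsPermGroup.id-closed H-group) fixes-id)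
  ... | h , h∈ , h≈id = lose h∈ (agree⁺ (λ _ → true) {v} {h}
        (agree-trans (agree⁻ (λ _ → true) {v} {idP} v≈id) (agree-≈P λ x → ≡.sym (h≈id x))))
  Fixer⊆id : ∀ {v} → v ∈≈ Fixer S H → v ∈≈ (idP ∷ [])
  Fixer⊆id {v} v∈ with find v∈
  ... | h , h∈ , v≈h = here (agree⁺ (λ _ → true) {v} {idP} (agree-trans (agree⁻ (λ _ → true) {v} {h} v≈h)
        (agreeing λ x _ → agree-at (proj₂ (∈-Fixer⁻ {P = S} {H = H} h∈)) x (everything x))))

pair : ∀ {n} → Fin n → Fin n → Fin n → Bool
pair u w v = ⌊ v ≟ u ⌋ ∨ ⌊ v ≟ w ⌋

module _ {n : ℕ} {u w : Fin n} {g : Perm n} where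

  fixes-pair⁺ : to g u ≡ u → to g w ≡ w → Fixes (pair u w) g
  fixes-pair⁺ gu≡u gw≡w = agreeing λ v v∈ → case Equivalence.to (T-∨ {⌊ v ≟ u ⌋}) v∈ of λ where
    (inj₁ v≡u) → ≡.subst (λ z → to g z ≡ z) (≡.sym (toWitness v≡u)) gu≡u
    (inj₂ v≡w) → ≡.subst (λ z → to g z ≡ z) (≡.sym (toWitness v≡w)) gw≡w

  fixes-pair⁻ : Fixes (pair u w) g → to g u ≡ u × to g w ≡ w
  fixes-pair⁻ g-fixes =
      agree-at g-fixes u (Equivalence.from (T-∨ {⌊ u ≟ u ⌋}) (inj₁ (fromWitness ≡.refl)))
    , agree-at g-fixes w (Equivalence.from (T-∨ {⌊ w ≟ u ⌋}) (inj₂ (fromWitness ≡.refl)))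

inducedOrder-stab2 : ∀ {n} (P : Fin n → Bool) N (u w : Fin n) →
  inducedOrder P (stab2 N u w) ≡ inducedOrder P (Fixer (pair u w) N)
inducedOrder-stab2 {n} P N u w = #classes-cong {stab2 N u w} {Fixer (pair u w) N}
  (λ {g} → ⊆-from-∈ (λ {x} → into {x}) {g}) (λ {g} → ⊆-from-∈ (λ {x} → back {x}) {g})
  where
  open Classes (agreement P)
  fixes-u-w? : (g : Perm n) → Dec (T (⌊ to g u ≟ u ⌋ ∧ ⌊ to g w ≟ w ⌋))
  fixes-u-w? g = T? (⌊ to g u ≟ u ⌋ ∧ ⌊ to g w ≟ w ⌋)
  into : ∀ {g} → g ∈ stab2 N u w → g ∈ Fixer (pair u w) N
  into {g} g∈ with ∈-filter⁻ fixes-u-w? {xs = N} g∈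
  ... | g∈N , fixed with Equivalence.to (T-∧ {⌊ to g u ≟ u ⌋}) fixed
  ... | gu≡u , gw≡w = ∈-Fixer⁺ g∈N (fixes-pair⁺ (toWitness gu≡u) (toWitness gw≡w))
  back : ∀ {g} → g ∈ Fixer (pair u w) N → g ∈ stab2 N u w
  back {g} g∈ with ∈-Fixer⁻ g∈
  ... | g∈N , g-fixes with fixes-pair⁻ g-fixes
  ... | gu≡u , gw≡w = ∈-filter⁺ fixes-u-w? g∈N
        (Equivalence.from (T-∧ {⌊ to g u ≟ u ⌋}) (fromWitness gu≡u , fromWitness gw≡w))

from-≡ : ∀ {n} (g : Perm n) {x y} → to g x ≡ y → from g y ≡ x
from-≡ g {x} gx≡y = ≡.trans (≡.cong (from g) (≡.sym gx≡y)) (from-to g x)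

conj : ∀ {n} → Perm n → Perm n → Perm n
conj g h = (g ∘P h) ∘P invP g

-- Conjugation by g carries restrictions to P onto restrictions to P' = g(P):
-- if it maps L into L' and conjugation by g⁻¹ maps L' into L, then L and L'
-- induce groups of the same order on P and P' respectively.
inducedOrder-conj : ∀ {n} (g : Perm n) {P P' : Fin n → Bool} {L L'} →
  (∀ x → T (P x) → T (P' (to g x))) → (∀ x → T (P' x) → T (P (from g x))) →
  (∀ {h} → h ∈ L → conj g h ∈G L') → (∀ {h'} → h' ∈ L' → conj (invP g) h' ∈G L) →
  inducedOrder P L ≡ inducedOrder P' L'
inducedOrder-conj g {P} {P'} {L} {L'} P→P' P'→P into onto =
  #classes-map (agreement P) (agreement P') (conj g) {L} {L'}
    (λ {h} {h'} h≈h' → agree⁺ P' {conj g h} {conj g h'} (conj-agree (agree⁻ P {h} {h'} h≈h')))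
    (λ {h} {h'} c≈c' → agree⁺ P {h} {h'} (conj-reflects (agree⁻ P' {conj g h} {conj g h'} c≈c')))
    (λ {v} → L⊆L' {v}) (λ {v} → L'⊆L {v})
  where
  module P' = DecSetoid (agreement P')
  open SetoidMembership P'.setoid using () renaming (_∈_ to _∈P'_)

  conj-agree : ∀ {h h'} → Agree P h h' → Agree P' (conj g h) (conj g h')
  conj-agree h≈h' = agreeing λ x x∈P' → ≡.cong (to g) (agree-at h≈h' (from g x) (P'→P x x∈P'))

  conj-reflects : ∀ {h h'} → Agree P' (conj g h) (conj g h') → Agree P h h'
  conj-reflects {h} {h'} c≈c' = agreeing λ x x∈P → begin
    to h x                       ≡⟨ ≡.cong (to h) (≡.sym (from-to g x)) ⟩
    to h (from g (to g x))       ≡⟨ agree-at h≈h'ᵍ⁻¹ (to g x) (P→P' x x∈P) ⟩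
    to h' (from g (to g x))      ≡⟨ ≡.cong (to h') (from-to g x) ⟩
    to h' x                      ∎
    where
    open ≡.≡-Reasoning
    h≈h'ᵍ⁻¹ : Agree P' (h ∘P invP g) (h' ∘P invP g)
    h≈h'ᵍ⁻¹ = agree-cancelˡ g (agreeing (agree-at c≈c'))

  conj-inverse : ∀ h' → conj g (conj (invP g) h') ≈P h'
  conj-inverse h' x = ≡.trans (to-from g _) (≡.cong (to h') (to-from g x))

  L⊆L' : ∀ {v} → v ∈P' map (conj g) L → v ∈P' L'
  L⊆L' {v} v∈ with find v∈
  ... | y , y∈ , v≈y with ∈-map⁻ (conj g) y∈
  ... | h , h∈L , ≡.refl with find (into h∈L)
  ... | h' , h'∈L' , h'≈c = lose h'∈L'
        (agree⁺ P' {v} {h'} (agree-trans (agree⁻ P' {v} {conj g h} v≈y) (agree-≈P λ x → ≡.sym (h'≈c x))))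

  L'⊆L : ∀ {v} → v ∈P' L' → v ∈P' map (conj g) L
  L'⊆L {v} v∈ with find v∈
  ... | h' , h'∈L' , v≈h' with find (onto h'∈L')
  ... | h , h∈L , h≈c = lose (∈-map⁺ (conj g) h∈L) (agree⁺ P' {v} {conj g h}
        (agree-trans (agree⁻ P' {v} {h'} v≈h')
          (agree-≈P λ x → ≡.trans (≡.sym (conj-inverse h' x)) (≡.cong (to g) (≡.sym (h≈c (from g x)))))))

PrimesDivide : ℕ → ℕ → Set
PrimesDivide m q = ∀ p → Prime p → p ∣ m → p ∣ q

primes-1 : ∀ {q} → PrimesDivide 1 q
primes-1 p p-prime p∣1 = ⊥-elim (¬prime[1] (≡.subst Prime (∣1⇒≡1 p∣1) p-prime))

primes-∣ : ∀ {m q} → m ∣ q → PrimesDivide m q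
primes-∣ m∣q p _ p∣m = ∣-trans p∣m m∣q

primes-* : ∀ {a b q} → PrimesDivide a q → PrimesDivide b q → PrimesDivide (a * b) q
primes-* {a} {b} a-ok b-ok p p-prime p∣ab with euclidsLemma a b p-prime p∣ab
... | inj₁ p∣a = a-ok p p-prime p∣a
... | inj₂ p∣b = b-ok p p-prime p∣b

outside : ∀ {n} → (Fin n → Bool) → List (Fin n) → List (Fin n)
outside S = filter (λ v → ¬? (T? (S v)))

module _ {n : ℕ} {S S' : Fin n → Bool} (S⊆S' : ∀ v → T (S v) → T (S' v)) where

  outside-≤ : ∀ xs → length (outside S' xs) ≤ length (outside S xs)
  outside-≤ [] = z≤n
  outside-≤ (x ∷ xs) with S x in x∈S | S' x in x∈S'
  ... | true  | true  = outside-≤ xs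
  ... | true  | false = ⊥-elim (≡.subst T x∈S' (S⊆S' x (≡.subst T (≡.sym x∈S) tt)))
  ... | false | true  = m≤n⇒m≤1+n (outside-≤ xs)
  ... | false | false = s≤s (outside-≤ xs)

  outside-< : ∀ {y} xs → y ∈ xs → T (S' y) → ¬ T (S y) → length (outside S' xs) < length (outside S xs)
  outside-< (x ∷ xs) y∈ y∈S' y∉S with S x in x∈S | S' x in x∈S' | y∈
  ... | true  | false | _           = ⊥-elim (≡.subst T x∈S' (S⊆S' x (≡.subst T (≡.sym x∈S) tt)))
  ... | true  | true  | here ≡.refl = ⊥-elim (y∉S (≡.subst T (≡.sym x∈S) tt))
  ... | true  | true  | there y∈xs  = outside-< xs y∈xs y∈S' y∉S
  ... | false | false | here ≡.refl = ⊥-elim (≡.subst T x∈S' y∈S')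
  ... | false | false | there y∈xs  = s≤s (outside-< xs y∈xs y∈S' y∉S)
  ... | false | true  | here ≡.refl = s≤s (outside-≤ xs)
  ... | false | true  | there y∈xs  = m≤n⇒m≤1+n (outside-< xs y∈xs y∈S' y∉S)

-- In a digraph invariant under a vertex-transitive group G every arc lies on a
-- directed cycle (follow the orbit of its tail under an element of G that maps
-- tail to head); hence weak connectivity implies strong connectivity.
module StrongConnectivity {n : ℕ} (R : Fin n → Fin n → Bool) {G : List (Perm n)}
    (R-invariant : ∀ {g x y} → g ∈G G → T (R x y) → T (R (to g x) (to g y)))
    (G-transitive : IsTransitive G) where

  Arc : Fin n → Fin n → Set
  Arc x y = T (R x y)

  fold-injective : ∀ (g : Perm n) i {x y} → fold x (to g) i ≡ fold y (to g) i → x ≡ y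
  fold-injective g zero e = e
  fold-injective g (suc i) e =
    fold-injective g i (≡.trans (≡.sym (from-to g _)) (≡.trans (≡.cong (from g) e) (from-to g _)))

  -- By pigeonhole on g⁰y, …, gⁿy, some positive power of g fixes y.
  orbit-returns : ∀ (g : Perm n) y → ∃ λ k → fold y (to g) (suc k) ≡ y
  orbit-returns g y with Fin.pigeonhole (n<1+n n) (λ (i : Fin (suc n)) → fold y (to g) (toℕ i))
  ... | i , j , i<j , gⁱy≡gʲy with m≤n⇒∃[o]m+o≡n i<j
  ... | k , 1+i+k≡j = k , fold-injective g (toℕ i) (begin
    fold (fold y (to g) (suc k)) (to g) (toℕ i)   ≡⟨ ≡.sym (fold-+ y (to g) (toℕ i)) ⟩
    fold y (to g) (toℕ i + suc k)                  ≡⟨ ≡.cong (fold y (to g)) (≡.trans (+-suc (toℕ i) k) 1+i+k≡j) ⟩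
    fold y (to g) (toℕ j)                          ≡⟨ ≡.sym gⁱy≡gʲy ⟩
    fold y (to g) (toℕ i)                          ∎)
    where open ≡.≡-Reasoning

  reverse : ∀ {x y} → Arc y x → Star Arc x y
  reverse {x} {y} y→x with G-transitive y x
  ... | g , g∈G , gy≡x with orbit-returns g y
  ... | k , gᵏ⁺¹y≡y = ≡.subst₂ (Star Arc) gy≡x gᵏ⁺¹y≡y (path k)
    where
    orbit : ℕ → Fin n
    orbit i = fold y (to g) i
    step : ∀ i → Arc (orbit i) (orbit (suc i))
    step zero = ≡.subst (Arc y) (≡.sym gy≡x) y→x
    step (suc i) = R-invariant {g} g∈G (step i)
    path : ∀ k → Star Arc (orbit 1) (orbit (suc k))
    path zero = ε
    path (suc k) = path k ◅◅ (step (suc k) ◅ ε)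

  strongly-connected : IsConnectedRel R → ∀ x y → Star Arc x y
  strongly-connected R-connected x y = follow (R-connected x y)
    where
    follow : ∀ {x y} → Star (SymClosure R) x y → Star Arc x y
    follow ε = ε
    follow (inj₁ x→z ◅ path) = x→z ◅ follow path
    follow (inj₂ z→x ◅ path) = reverse z→x ◅◅ follow path

module OrbitalDigraph {n : ℕ} {G N : List (Perm n)} {a b : Fin n}
    (G-group : IsPermGroup G) (G-transitive : IsTransitive G) (N-normal : IsNormalSubgroup N G)
    (Δ-connected : IsConnectedRel (arcOrbit G a b)) {α β : Fin n} (α→β : T (arcOrbit G a b α β)) where

  private
    module G = IsPermGroup G-group
    N-group : IsPermGroup N
    N-group = proj₁ N-normal
    N⊆G : N ⊆G G
    N⊆G = proj₁ (proj₂ N-normal)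
    N-conj : ∀ g h → g ∈G G → h ∈G N → conj g h ∈G N
    N-conj = proj₂ (proj₂ N-normal)

  Δ : Fin n → Fin n → Bool
  Δ = arcOrbit G a b

  arc⁻ : ∀ {x y} → T (Δ x y) → ∃ λ g → g ∈ G × to g a ≡ x × to g b ≡ y
  arc⁻ {x} {y} x→y with find (any⁻ (λ g → ⌊ to g a ≟ x ⌋ ∧ ⌊ to g b ≟ y ⌋) G x→y)
  ... | g , g∈G , match with Equivalence.to (T-∧ {⌊ to g a ≟ x ⌋}) match
  ... | ga≡x , gb≡y = g , g∈G , toWitness ga≡x , toWitness gb≡y

  arc⁺ : ∀ {g x y} → g ∈ G → to g a ≡ x → to g b ≡ y → T (Δ x y)
  arc⁺ {g} {x} {y} g∈G ga≡x gb≡y = any⁺ (λ g → ⌊ to g a ≟ x ⌋ ∧ ⌊ to g b ≟ y ⌋)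
    (lose g∈G (Equivalence.from (T-∧ {⌊ to g a ≟ x ⌋}) (fromWitness ga≡x , fromWitness gb≡y)))

  Δ-invariant : ∀ {g x y} → g ∈G G → T (Δ x y) → T (Δ (to g x) (to g y))
  Δ-invariant {g} {x} {y} g∈G x→y with arc⁻ x→y
  ... | h , h∈G , ha≡x , hb≡y with find (G.comp-closed g h g∈G (∈⇒∈G h∈G))
  ... | k , k∈G , k≈gh =
    arc⁺ {k} k∈G (≡.trans (k≈gh a) (≡.cong (to g) ha≡x)) (≡.trans (k≈gh b) (≡.cong (to g) hb≡y))

  arc-transport : ∀ {u w u' w'} → T (Δ u w) → T (Δ u' w') →
    ∃ λ g → g ∈G G × to g u ≡ u' × to g w ≡ w'
  arc-transport {u} {w} u→w u'→w' with arc⁻ u→w | arc⁻ u'→w'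
  ... | g₁ , g₁∈G , g₁a≡u , g₁b≡w | g₂ , g₂∈G , g₂a≡u' , g₂b≡w' =
      g₂ ∘P invP g₁
    , G.comp-closed g₂ (invP g₁) (∈⇒∈G g₂∈G) (G.inv-closed g₁ (∈⇒∈G g₁∈G))
    , moves g₁a≡u g₂a≡u' , moves g₁b≡w g₂b≡w'
    where
    moves : ∀ {c x x'} → to g₁ c ≡ x → to g₂ c ≡ x' → to g₂ (from g₁ x) ≡ x'
    moves g₁c≡x g₂c≡x' = ≡.trans (≡.cong (to g₂) (from-≡ g₁ g₁c≡x)) g₂c≡x'

  conj-stabiliser : ∀ {g u w u' w' h} → g ∈G G → to g u ≡ u' → to g w ≡ w' →
    h ∈ Fixer (pair u w) N → conj g h ∈G Fixer (pair u' w') N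
  conj-stabiliser {g} {u} {w} {u'} {w'} {h} g∈G gu≡u' gw≡w' h∈ with ∈-Fixer⁻ h∈
  ... | h∈N , h-fixes with fixes-pair⁻ h-fixes
  ... | hu≡u , hw≡w = ∈G-Fixer⁺ {g = conj g h} (N-conj g h g∈G (∈⇒∈G h∈N))
                        (fixes-pair⁺ (fixed gu≡u' hu≡u) (fixed gw≡w' hw≡w))
    where
    fixed : ∀ {x x'} → to g x ≡ x' → to h x ≡ x → to (conj g h) x' ≡ x'
    fixed {x} gx≡x' hx≡x = ≡.trans (≡.cong (λ z → to g (to h z)) (from-≡ g gx≡x'))
                                   (≡.trans (≡.cong (to g) hx≡x) gx≡x')

  local : Fin n → Fin n → ℕ
  local u w = inducedOrder (Δ w) (Fixer (pair u w) N)

  local-invariant : ∀ {u w u' w'} → T (Δ u w) → T (Δ u' w') → local u w ≡ local u' w'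
  local-invariant u→w u'→w' with arc-transport u→w u'→w'
  ... | g , g∈G , gu≡u' , gw≡w' = inducedOrder-conj g
    (λ x w→x → ≡.subst (λ z → T (Δ z (to g x))) gw≡w' (Δ-invariant {g} g∈G w→x))
    (λ x w'→x → ≡.subst (λ z → T (Δ z (from g x))) (from-≡ g gw≡w') (Δ-invariant {invP g} g⁻¹∈G w'→x))
    (conj-stabiliser {g} g∈G gu≡u' gw≡w')
    (conj-stabiliser {invP g} g⁻¹∈G (from-≡ g gu≡u') (from-≡ g gw≡w'))
    where
    g⁻¹∈G : invP g ∈G G
    g⁻¹∈G = G.inv-closed g g∈G

  open StrongConnectivity Δ (λ {g} → Δ-invariant {g}) G-transitive using (Arc; strongly-connected)

  q : ℕ
  q = local α β

  -- For an arc u → w inside S, N_(S) ≤ N_uw and N_(S) maps Δ(w) into itself,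
  -- so |N_(S)^Δ(w)| divides |N_uw^Δ(w)| = q.
  local-divides : ∀ {S u w} → T (S u) → T (S w) → T (Δ u w) → inducedOrder (Δ w) (Fixer S N) ∣ q
  local-divides {S} {u} {w} u∈S w∈S u→w =
    ≡.subst (inducedOrder (Δ w) (Fixer S N) ∣_) (local-invariant u→w α→β)
      (inducedOrder-∣ (Δ w) (fixer-group N-group) (fixer-group N-group) N[S]⊆N[uw] N[S]-preserves)
    where
    N[S]⊆N[uw] : Fixer S N ⊆G Fixer (pair u w) N
    N[S]⊆N[uw] g g∈ with ∈G-Fixer⁻ {g = g} g∈
    ... | g∈N , g-fixes =
      ∈G-Fixer⁺ {g = g} g∈N (fixes-pair⁺ (agree-at g-fixes u u∈S) (agree-at g-fixes w w∈S))
    N[S]-preserves : ∀ {k} → k ∈ Fixer S N → Preserves (Δ w) k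
    N[S]-preserves {k} k∈ x w→x with ∈-Fixer⁻ k∈
    ... | k∈N , k-fixes = ≡.subst (λ z → T (Δ z (to k x))) (agree-at k-fixes w w∈S)
                            (Δ-invariant {k} (N⊆G k (∈⇒∈G k∈N)) w→x)

  Expandable : (Fin n → Bool) → Set
  Expandable S = ∃ λ u → ∃ λ w → ∃ λ y → T (S u) × T (S w) × T (Δ u w) × T (Δ w y) × ¬ T (S y)

  expandable? : ∀ S → Dec (Expandable S)
  expandable? S = Fin.any? λ u → Fin.any? λ w → Fin.any? λ y →
    T? (S u) ×-dec T? (S w) ×-dec T? (Δ u w) ×-dec T? (Δ w y) ×-dec ¬? (T? (S y))

  -- A set containing α and β that cannot grow contains every vertex reachable
  -- from β, which by strong connectivity is every vertex.
  unexpandable⇒everything : ∀ {S} → T (S α) → T (S β) → ¬ Expandable S → ∀ v → T (S v)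
  unexpandable⇒everything {S} α∈S β∈S stuck v = walk α∈S β∈S α→β (strongly-connected Δ-connected β v)
    where
    walk : ∀ {u w v} → T (S u) → T (S w) → T (Δ u w) → Star Arc w v → T (S v)
    walk u∈S w∈S u→w ε = w∈S
    walk {u} {w} u∈S w∈S u→w (_◅_ {j = y} w→y path) with T? (S y)
    ... | yes y∈S = walk w∈S y∈S w→y path
    ... | no y∉S = ⊥-elim (stuck (u , w , y , u∈S , w∈S , u→w , w→y , y∉S))

  -- π(|N_(S)|) ⊆ π(q) for every S ∋ α, β, by induction on the number m of
  -- vertices outside S: |N_(S)| = |N_(S)^Δ(w)| · |N_(S ∪ Δ(w))|, where the first
  -- factor divides q and S ∪ Δ(w) has fewer outside vertices.
  fixer-primes : ∀ m S → length (outside S (allFin n)) ≤ m → T (S α) → T (S β) →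
    PrimesDivide (order (Fixer S N)) q
  fixer-primes m S bound α∈S β∈S with expandable? S
  ... | no stuck = ≡.subst (λ k → PrimesDivide k q)
        (≡.sym (order-Fixer-all N-group (unexpandable⇒everything α∈S β∈S stuck))) primes-1
  ... | yes (u , w , y , u∈S , w∈S , u→w , w→y , y∉S) =
        ≡.subst (λ k → PrimesDivide k q) (≡.sym (order-Fixer-split {S = S} {P = Δ w} N-group))
          (primes-* (primes-∣ (local-divides u∈S w∈S u→w)) (extended m bound))
    where
    S⊆S∪Δw : ∀ v → T (S v) → T ((S ∪ Δ w) v)
    S⊆S∪Δw v v∈S = Equivalence.from (T-∨ {S v}) (inj₁ v∈S)
    shrinks : length (outside (S ∪ Δ w) (allFin n)) < length (outside S (allFin n))
    shrinks = outside-< S⊆S∪Δw (allFin n) (∈-allFin y) (Equivalence.from (T-∨ {S y}) (inj₂ w→y)) y∉S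
    extended : ∀ m → length (outside S (allFin n)) ≤ m → PrimesDivide (order (Fixer (S ∪ Δ w) N)) q
    extended zero bound = ⊥-elim (n≮0 (<-≤-trans shrinks bound))
    extended (suc m) bound = fixer-primes m (S ∪ Δ w) (≤-pred (<-≤-trans shrinks bound))
      (S⊆S∪Δw α α∈S) (S⊆S∪Δw β β∈S)

  -- q divides |N_αβ|, since N_αβ^Δ(β) is a quotient of N_αβ.
  q∣stabiliser : q ∣ order (Fixer (pair α β) N)
  q∣stabiliser = ≡.subst (q ∣_) (≡.sym (order-restriction (Δ β) (fixer-group N-group))) (m∣m*n _)

  same-primes : SamePrimeDivisors q (order (Fixer (pair α β) N))
  same-primes p p-prime = mk⇔ (λ p∣q → ∣-trans p∣q q∣stabiliser)
    (fixer-primes _ (pair α β) ≤-refl α∈αβ β∈αβ p p-prime)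
    where
    α∈αβ : T (pair α β α)
    α∈αβ = Equivalence.from (T-∨ {⌊ α ≟ α ⌋}) (inj₁ (fromWitness ≡.refl))
    β∈αβ : T (pair α β β)
    β∈αβ = Equivalence.from (T-∨ {⌊ β ≟ α ⌋}) (inj₂ (fromWitness ≡.refl))

-- N_αβ = stab2 N α β is the pointwise stabiliser of {α, β} in N, so the
-- statement is OrbitalDigraph.same-primes; only the group structure of G ≤ Aut Γ
-- is used.
lemma2p2 : (n : ℕ) (Γ : SimpleGraph n) (G N : List (Perm n)) (a b : Fin n) →
    IsConnected Γ → IsRegular Γ → IsAutGroup Γ G → IsTransitive G →
    IsNormalSubgroup N G → NonTrivial N → T (Adj Γ a b) →
    IsConnectedRel (arcOrbit G a b) →
    (α β : Fin n) → T (arcOrbit G a b α β) →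
    SamePrimeDivisors (inducedOrder (arcOrbit G a b β) (stab2 N α β)) (order (stab2 N α β))
lemma2p2 _ _ G N a b _ _ (G-group , _) G-transitive N-normal _ _ Δ-connected α β α→β =
  ≡.subst₂ SamePrimeDivisors
    (≡.sym (inducedOrder-stab2 (arcOrbit G a b β) N α β)) (≡.sym (inducedOrder-stab2 (λ _ → true) N α β))
    same-primes
  where open OrbitalDigraph G-group G-transitive N-normal Δ-connected α→β
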